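{- Let $a$ be a positive integer and $m\in\mathbb{Z}_{\geq 2}$. With $$f_{m,a}(r)=\frac{1}{(1+a)^r}\sum_{i=0}^{r}\binom{m}{i}a^i,\qquad r_a=\Big\lfloor\frac{am-(a-1)}{2a+1}\Big\rfloor+1,$$ we have $f_{m,a}(r_a)>f_{m,a}(r_a+1)$. -}

module Defs where

open import Data.Nat using (ℕ; zero; suc; _+_; _*_; _∸_; _^_; _/_)
open import Data.Nat.Properties using (m^n≢0)
open import Data.Nat.Combinatorics using (_C_)
open import Data.Integer using (+_)
open import Data.Rational using (ℚ) renaming (_/_ to _/ℚ_)

binomSum : ℕ → ℕ → ℕ → ℕ
binomSum m a zero    = (m C 0) * a ^ 0
binomSum m a (suc r) = binomSum m a r + (m C suc r) * a ^ suc r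

f : ℕ → ℕ → ℕ → ℚ
f m a r = _/ℚ_ (+ binomSum m a r) ((1 + a) ^ r) {{m^n≢0 (1 + a) r}}

-- r_a = ⌊(a m - (a-1)) / (2a+1)⌋ + 1   (numerator is ≥ 0 since m ≥ 2, so ∸ is exact)
rₐ : ℕ → ℕ → ℕ
rₐ m a = ((a * m ∸ (a ∸ 1)) / suc (2 * a)) + 1

-- Writing t k = C(m,k) aᵏ and S r = t 0 + … + t r, the inequality f(r) > f(r+1) says
-- exactly t (r+1) < a · S r. For a weight c : ℤ → ℤ and a constant B, the quantity
-- (j+1) t(j+1) c(j) − B · S j can only decrease in j as long as a(m−Y) c(Y) ≤ Y c(Y−1) + B,
-- because (j+1) t(j+1) = a(m−j) t(j); it starts negative, so it stays negative. With the
-- linear weight c(Y) = N + (a+1) K (Y − r) and B = a(r+1)N, evaluating at j = r gives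
-- t (r+1) < a · S r. The condition on c asks a quadratic in Y to be positive; its discriminant
-- is −(a+1)² N (K² − N), and K² − N > 0 is where the choice of rₐ enters, through
-- a m + 2 ≤ (2a+1) rₐ + a.

{-# OPTIONS --safe #-}
module Submission where

open import Defs
open import Data.Nat using (ℕ; zero; suc; NonZero; z≤n; s≤s)
import Data.Nat as ℕ
import Data.Nat.Properties as ℕ
import Data.Rational as ℚ
open import Data.Nat.Combinatorics using (_C_; nCk+nC[k+1]≡[n+1]C[k+1]; nC1≡n; k>n⇒nCk≡0)
open import Relation.Binary.PropositionalEquality

module _ where
  open import Data.Nat using (_≤_; _<_; _+_; _*_; _∸_; _/_; _%_)
  open import Data.Nat.DivMod using (m≡m%n+[m/n]*n; m%n<n)
  open import Data.Nat.Tactic.RingSolver using (solve-∀)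

  [k+1]*[n+1]C[k+1]≡[n+1]*nCk : ∀ n k → suc k * (suc n C suc k) ≡ suc n * (n C k)
  [k+1]*[n+1]C[k+1]≡[n+1]*nCk zero zero = refl
  [k+1]*[n+1]C[k+1]≡[n+1]*nCk zero (suc k)
    rewrite k>n⇒nCk≡0 {1} {suc (suc k)} (s≤s (s≤s z≤n)) | k>n⇒nCk≡0 {0} {suc k} (s≤s z≤n)
    = ℕ.*-zeroʳ (suc (suc k))
  [k+1]*[n+1]C[k+1]≡[n+1]*nCk (suc n) zero =
    trans (ℕ.+-identityʳ _) (trans (nC1≡n (suc (suc n))) (sym (ℕ.*-identityʳ _)))
  [k+1]*[n+1]C[k+1]≡[n+1]*nCk (suc n) (suc k) = begin
    suc (suc k) * (suc (suc n) C suc (suc k))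
      ≡⟨ cong (suc (suc k) *_) (sym (nCk+nC[k+1]≡[n+1]C[k+1] (suc n) (suc k))) ⟩
    suc (suc k) * (x + y)
      ≡⟨ distribute k x y ⟩
    x + (suc k * x + suc (suc k) * y)
      ≡⟨ cong₂ (λ u v → x + (u + v)) ([k+1]*[n+1]C[k+1]≡[n+1]*nCk n k)
                                     ([k+1]*[n+1]C[k+1]≡[n+1]*nCk n (suc k)) ⟩
    x + (suc n * (n C k) + suc n * (n C suc k))
      ≡⟨ cong (x +_) (sym (ℕ.*-distribˡ-+ (suc n) (n C k) (n C suc k))) ⟩
    x + suc n * (n C k + n C suc k)
      ≡⟨ cong (λ u → x + suc n * u) (nCk+nC[k+1]≡[n+1]C[k+1] n k) ⟩
    x + suc n * x
      ∎
    where
    open ≡-Reasoning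
    x = suc n C suc k
    y = suc n C suc (suc k)
    distribute : ∀ k x y → suc (suc k) * (x + y) ≡ x + (suc k * x + suc (suc k) * y)
    distribute = solve-∀

  m<n*[m/n+1] : ∀ m n .{{_ : NonZero n}} → m < n * (m / n + 1)
  m<n*[m/n+1] m n = begin-strict
    m                   ≡⟨ m≡m%n+[m/n]*n m n ⟩
    m % n + m / n * n   <⟨ ℕ.+-monoˡ-< (m / n * n) (m%n<n m n) ⟩
    n + m / n * n       ≡⟨ reassociate n (m / n) ⟩
    n * (m / n + 1)     ∎
    where
    open ℕ.≤-Reasoning
    reassociate : ∀ n q → n + q * n ≡ n * (q + 1)
    reassociate = solve-∀

  rₐ-bound : ∀ {a m} → 1 ≤ a → 1 ≤ m → a * m + 2 ≤ suc (2 * a) * rₐ m a + a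
  rₐ-bound {suc a'} {m@(suc _)} _ _ = begin
    a * m + 2                  ≡⟨ cong (_+ 2) (sym (ℕ.m∸n+n≡m a'≤a*m)) ⟩
    (a * m ∸ a') + a' + 2      ≡⟨ shift (a * m ∸ a') a' ⟩
    suc (a * m ∸ a') + a       ≤⟨ ℕ.+-monoˡ-≤ a (m<n*[m/n+1] (a * m ∸ a') (suc (2 * a))) ⟩
    suc (2 * a) * rₐ m a + a   ∎
    where
    open ℕ.≤-Reasoning
    a = suc a'
    a'≤a*m : a' ≤ a * m
    a'≤a*m = ℕ.≤-trans (ℕ.n≤1+n a') (ℕ.m≤m*n a m)
    shift : ∀ x a' → x + a' + 2 ≡ suc x + suc a'
    shift = solve-∀

module _ where
  open import Data.Integer
    using (ℤ; +_; -[1+_]; 0ℤ; 1ℤ; _+_; _-_; _*_; _≤_; _<_; +≤+; +<+)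
  open import Data.Integer.Base using (nonNegative)
  open import Data.Integer.Properties
    using ( drop‿+<+; pos-+; pos-*; positive⁻¹; nonNegative⁻¹; ≤-trans; <⇒≤; i≤j⇒0≤j-i
          ; +-identityˡ; +-identityʳ; *-identityʳ; *-zeroʳ; *-distribˡ-+
          ; +-mono-≤; +-mono-≤-<; +-mono-<-≤; +-monoˡ-<; +-monoʳ-<
          ; *-monoˡ-≤-nonNeg; *-cancelˡ-<-nonNeg; module ≤-Reasoning )
  open import Data.Integer.Tactic.RingSolver using (solve-∀)
  open ≤-Reasoning

  *-nonNeg : ∀ {i j} → 0ℤ ≤ i → 0ℤ ≤ j → 0ℤ ≤ i * j
  *-nonNeg {+ m} {+ n} (+≤+ _) (+≤+ _) = subst (0ℤ ≤_) (pos-* m n) (+≤+ z≤n)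

  *-pos : ∀ {i j} → 0ℤ < i → 0ℤ < j → 0ℤ < i * j
  *-pos (+<+ (s≤s z≤n)) (+<+ (s≤s z≤n)) = +<+ (s≤s z≤n)

  square-nonNeg : ∀ i → 0ℤ ≤ i * i
  square-nonNeg (+ n)    = *-nonNeg {+ n} {+ n} (+≤+ z≤n) (+≤+ z≤n)
  square-nonNeg -[1+ n ] = +≤+ z≤n

  0<j-i⇒i<j : ∀ {i j} → 0ℤ < j - i → i < j
  0<j-i⇒i<j {i} {j} 0<j-i = begin-strict
    i            ≡⟨ +-identityʳ i ⟨
    i + 0ℤ       <⟨ +-monoʳ-< i 0<j-i ⟩
    i + (j - i)  ≡⟨ cancel i j ⟩
    j            ∎
    where
    cancel : ∀ i j → i + (j - i) ≡ j
    cancel = solve-∀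

  quadratic-pos : ∀ α β γ Y → 0ℤ < α → 0ℤ < + 4 * α * γ - β * β →
                  0ℤ < α * Y * Y + β * Y + γ
  quadratic-pos α β γ Y 0<α 0<Δ =
    *-cancelˡ-<-nonNeg (+ 4 * α) {{nonNegative (<⇒≤ 0<4α)}} (begin-strict
      + 4 * α * 0ℤ                                      ≡⟨ *-zeroʳ (+ 4 * α) ⟩
      0ℤ + 0ℤ                                           <⟨ +-mono-≤-< (square-nonNeg W) 0<Δ ⟩
      W * W + (+ 4 * α * γ - β * β)                     ≡⟨ complete-square α β γ Y ⟩
      + 4 * α * (α * Y * Y + β * Y + γ)                 ∎)
    where
    W = + 2 * α * Y + β
    0<4α : 0ℤ < + 4 * α
    0<4α = *-pos (positive⁻¹ (+ 4)) 0<α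
    complete-square : ∀ α β γ Y → (+ 2 * α * Y + β) * (+ 2 * α * Y + β) + (+ 4 * α * γ - β * β)
                                  ≡ + 4 * α * (α * Y * Y + β * Y + γ)
    complete-square = solve-∀

  term : ℕ → ℕ → ℕ → ℤ
  term m a k = + ((m C k) ℕ.* a ℕ.^ k)

  term-recurrence : ∀ m a k → + suc k * term m a (suc k) ≡ + a * (+ m - + k) * term m a k
  term-recurrence m a k = begin-equality
    (1ℤ + + k) * + (y ℕ.* (a ℕ.* p))
      ≡⟨ cong ((1ℤ + + k) *_) (trans (pos-* y (a ℕ.* p)) (cong (+ y *_) (pos-* a p))) ⟩
    (1ℤ + + k) * (+ y * (+ a * + p))
      ≡⟨ isolate (1ℤ + + k) (+ x) (+ y) (+ a) (+ p) ⟩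
    + a * + p * ((1ℤ + + k) * (+ x + + y) - (1ℤ + + k) * + x)
      ≡⟨ cong (λ z → + a * + p * (z - (1ℤ + + k) * + x)) absorption ⟩
    + a * + p * ((1ℤ + + m) * + x - (1ℤ + + k) * + x)
      ≡⟨ collect (+ a) (+ p) (+ m) (+ k) (+ x) ⟩
    + a * (+ m - + k) * (+ x * + p)
      ≡⟨ cong (+ a * (+ m - + k) *_) (pos-* x p) ⟨
    + a * (+ m - + k) * + (x ℕ.* p)
      ∎
    where
    x = m C k
    y = m C suc k
    p = a ℕ.^ k
    absorption : + suc k * (+ x + + y) ≡ + suc m * + x
    absorption = begin-equality
      + suc k * (+ x + + y)      ≡⟨ cong (+ suc k *_) (pos-+ x y) ⟨
      + suc k * + (x ℕ.+ y)      ≡⟨ pos-* (suc k) (x ℕ.+ y) ⟨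
      + (suc k ℕ.* (x ℕ.+ y))    ≡⟨ cong (λ z → + (suc k ℕ.* z)) (nCk+nC[k+1]≡[n+1]C[k+1] m k) ⟩
      + (suc k ℕ.* (suc m C suc k)) ≡⟨ cong +_ ([k+1]*[n+1]C[k+1]≡[n+1]*nCk m k) ⟩
      + (suc m ℕ.* x)            ≡⟨ pos-* (suc m) x ⟩
      + suc m * + x              ∎
    isolate : ∀ k x y a p → k * (y * (a * p)) ≡ a * p * (k * (x + y) - k * x)
    isolate = solve-∀
    collect : ∀ a p m k x → a * p * ((1ℤ + m) * x - (1ℤ + k) * x) ≡ a * (m - k) * (x * p)
    collect = solve-∀

  module _ (m a : ℕ) (c : ℤ → ℤ) (B : ℤ)
           (c-step : ∀ Y → + a * (+ m - Y) * c Y < Y * c (Y - 1ℤ) + B) where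

    weighted-term<bound*partialSum :
      ∀ j → + suc j * term m a (suc j) * c (+ j) < B * + binomSum m a j
    weighted-term<bound*partialSum zero = begin-strict
      + 1 * term m a 1 * c 0ℤ          ≡⟨ cong (_* c 0ℤ) (term-recurrence m a 0) ⟩
      + a * (+ m - 0ℤ) * + 1 * c 0ℤ    ≡⟨ cong (_* c 0ℤ) (*-identityʳ (+ a * (+ m - 0ℤ))) ⟩
      + a * (+ m - 0ℤ) * c 0ℤ          <⟨ c-step 0ℤ ⟩
      0ℤ + B                           ≡⟨ +-identityˡ B ⟩
      B                                ≡⟨ *-identityʳ B ⟨
      B * + 1                          ∎
    weighted-term<bound*partialSum (suc j) = begin-strict
      + suc (suc j) * term m a (suc (suc j)) * c (+ suc j)
        ≡⟨ cong (_* c (+ suc j)) (term-recurrence m a (suc j)) ⟩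
      + a * (+ m - + suc j) * t * c (+ suc j)
        ≡⟨ pull-out (+ a * (+ m - + suc j)) t (c (+ suc j)) ⟩
      t * (+ a * (+ m - + suc j) * c (+ suc j))
        ≤⟨ *-monoˡ-≤-nonNeg t (<⇒≤ (c-step (+ suc j))) ⟩
      t * (+ suc j * c (+ j) + B)
        ≡⟨ distribute t (+ suc j) (c (+ j)) B ⟩
      + suc j * t * c (+ j) + B * t
        <⟨ +-monoˡ-< (B * t) (weighted-term<bound*partialSum j) ⟩
      B * + binomSum m a j + B * t
        ≡⟨ *-distribˡ-+ B (+ binomSum m a j) t ⟨
      B * (+ binomSum m a j + t)
        ≡⟨ cong (B *_) (pos-+ (binomSum m a j) _) ⟨
      B * + binomSum m a (suc j)
        ∎
      where
      t = term m a (suc j)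
      pull-out : ∀ u t v → u * t * v ≡ t * (u * v)
      pull-out = solve-∀
      distribute : ∀ t u v b → t * (u * v + b) ≡ u * t * v + b * t
      distribute = solve-∀

  gap-identity : ∀ A M R U V Y →
    let c Z = V + U * (Z - R) in
    Y * c (Y - 1ℤ) + A * (R + 1ℤ) * V - A * (M - Y) * c Y
      ≡ (A + 1ℤ) * U * Y * Y + ((A + 1ℤ) * V - U * ((A + 1ℤ) * R + A * M + 1ℤ)) * Y
        + (V * (A * (R + 1ℤ) - A * M) + A * M * U * R)
  gap-identity = solve-∀

  -- The last factor is K² − N.
  discriminant-identity : ∀ A M R →
    let P = A * M
        X = (A + 1ℤ) * R
        S = X + P
        E = (1ℤ + + 2 * A) * R + A - (P + + 2)
        K = + 3 + A * (R + 1ℤ) + E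
        N = (X - P) * (X - P) + + 2 * S + 1ℤ
        U = (A + 1ℤ) * K
    in + 4 * ((A + 1ℤ) * U) * (N * (A * (R + 1ℤ) - P) + P * U * R)
         - ((A + 1ℤ) * N - U * (S + 1ℤ)) * ((A + 1ℤ) * N - U * (S + 1ℤ))
       ≡ (A + 1ℤ) * (A + 1ℤ) * N
         * (+ 16 + + 4 * (R + + 2) * (A - 1ℤ) + + 4 * (A * (R + 1ℤ) + 1ℤ) * E)
  discriminant-identity = solve-∀

  module Weight (A M R : ℤ) where
    P X S E K N U : ℤ
    P = A * M
    X = (A + 1ℤ) * R
    S = X + P
    E = (1ℤ + + 2 * A) * R + A - (P + + 2)
    K = + 3 + A * (R + 1ℤ) + E
    N = (X - P) * (X - P) + + 2 * S + 1ℤ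
    U = (A + 1ℤ) * K

    weight : ℤ → ℤ
    weight Y = N + U * (Y - R)

    bound : ℤ
    bound = A * (R + 1ℤ) * N

    0<N : 0ℤ ≤ A → 0ℤ ≤ M → 0ℤ ≤ R → 0ℤ < N
    0<N 0≤A 0≤M 0≤R =
      +-mono-≤-< (+-mono-≤ (square-nonNeg (X - P)) (*-nonNeg (nonNegative⁻¹ (+ 2)) 0≤S))
                 (positive⁻¹ 1ℤ)
      where
      0≤S : 0ℤ ≤ S
      0≤S = +-mono-≤ (*-nonNeg (+-mono-≤ 0≤A (nonNegative⁻¹ 1ℤ)) 0≤R) (*-nonNeg 0≤A 0≤M)

    weight-step : 1ℤ ≤ A → 0ℤ ≤ M → 0ℤ ≤ R → A * M + + 2 ≤ (1ℤ + + 2 * A) * R + A →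
                  ∀ Y → A * (M - Y) * weight Y < Y * weight (Y - 1ℤ) + bound
    weight-step 1≤A 0≤M 0≤R slack Y =
      0<j-i⇒i<j (subst (0ℤ <_) (sym (gap-identity A M R U N Y)) (quadratic-pos α β γ Y 0<α 0<Δ))
      where
      α = (A + 1ℤ) * U
      β = (A + 1ℤ) * N - U * (S + 1ℤ)
      γ = N * (A * (R + 1ℤ) - P) + P * U * R
      0≤A : 0ℤ ≤ A
      0≤A = ≤-trans (+≤+ z≤n) 1≤A
      0≤E : 0ℤ ≤ E
      0≤E = i≤j⇒0≤j-i slack
      0<A+1 : 0ℤ < A + 1ℤ
      0<A+1 = +-mono-≤-< 0≤A (positive⁻¹ 1ℤ)
      0≤R+1 : 0ℤ ≤ R + 1ℤ
      0≤R+1 = +-mono-≤ 0≤R (nonNegative⁻¹ 1ℤ)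
      0<K : 0ℤ < K
      0<K = +-mono-<-≤ (+-mono-<-≤ (positive⁻¹ (+ 3)) (*-nonNeg 0≤A 0≤R+1)) 0≤E
      0<K²-N : 0ℤ < + 16 + + 4 * (R + + 2) * (A - 1ℤ) + + 4 * (A * (R + 1ℤ) + 1ℤ) * E
      0<K²-N = +-mono-<-≤ (+-mono-<-≤ (positive⁻¹ (+ 16))
                 (*-nonNeg (*-nonNeg (nonNegative⁻¹ (+ 4)) (+-mono-≤ 0≤R (nonNegative⁻¹ (+ 2))))
                           (i≤j⇒0≤j-i 1≤A)))
                 (*-nonNeg (*-nonNeg (nonNegative⁻¹ (+ 4))
                                     (+-mono-≤ (*-nonNeg 0≤A 0≤R+1) (nonNegative⁻¹ 1ℤ)))
                           0≤E)
      0<α : 0ℤ < α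
      0<α = *-pos 0<A+1 (*-pos 0<A+1 0<K)
      0<Δ : 0ℤ < + 4 * α * γ - β * β
      0<Δ = subst (0ℤ <_) (sym (discriminant-identity A M R))
              (*-pos (*-pos (*-pos 0<A+1 0<A+1) (0<N 0≤A 0≤M 0≤R)) 0<K²-N)

  term<a*partialSum : ∀ {a} m r → 1 ℕ.≤ a → a ℕ.* m ℕ.+ 2 ℕ.≤ suc (2 ℕ.* a) ℕ.* r ℕ.+ a →
                      (m C suc r) ℕ.* a ℕ.^ suc r ℕ.< a ℕ.* binomSum m a r
  term<a*partialSum {a} m r 1≤a slack =
    drop‿+<+ (*-cancelˡ-<-nonNeg ((1ℤ + + r) * N) {{nonNegative (<⇒≤ 0<[1+r]N)}} (begin-strict
      (1ℤ + + r) * N * term m a (suc r)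
        ≡⟨ weight-at-R (+ r) N U (term m a (suc r)) ⟩
      (1ℤ + + r) * term m a (suc r) * weight (+ r)
        <⟨ weighted-term<bound*partialSum m a weight bound
             (weight-step (+≤+ 1≤a) (nonNegative⁻¹ (+ m)) (nonNegative⁻¹ (+ r)) slackℤ) r ⟩
      bound * + binomSum m a r
        ≡⟨ regroup (+ a) (+ r) N (+ binomSum m a r) ⟩
      (1ℤ + + r) * N * (+ a * + binomSum m a r)
        ≡⟨ cong ((1ℤ + + r) * N *_) (pos-* a (binomSum m a r)) ⟨
      (1ℤ + + r) * N * + (a ℕ.* binomSum m a r)
        ∎))
    where
    open Weight (+ a) (+ m) (+ r)
    0<[1+r]N : 0ℤ < (1ℤ + + r) * N
    0<[1+r]N = *-pos (positive⁻¹ (1ℤ + + r))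
                     (0<N (nonNegative⁻¹ (+ a)) (nonNegative⁻¹ (+ m)) (nonNegative⁻¹ (+ r)))
    slackℤ : + a * + m + + 2 ≤ (1ℤ + + 2 * + a) * + r + + a
    slackℤ = subst₂ _≤_ cast-lhs cast-rhs (+≤+ slack)
      where
      cast-lhs : + (a ℕ.* m ℕ.+ 2) ≡ + a * + m + + 2
      cast-lhs = trans (pos-+ (a ℕ.* m) 2) (cong (_+ + 2) (pos-* a m))
      cast-rhs : + (suc (2 ℕ.* a) ℕ.* r ℕ.+ a) ≡ (1ℤ + + 2 * + a) * + r + + a
      cast-rhs = trans (pos-+ (suc (2 ℕ.* a) ℕ.* r) a)
                   (cong (_+ + a) (trans (pos-* (suc (2 ℕ.* a)) r)
                                         (cong (λ z → (1ℤ + z) * + r) (pos-* 2 a))))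
    weight-at-R : ∀ r n u t → (1ℤ + r) * n * t ≡ (1ℤ + r) * t * (n + u * (r - r))
    weight-at-R = solve-∀
    regroup : ∀ a r n s → a * (r + 1ℤ) * n * s ≡ (1ℤ + r) * n * (a * s)
    regroup = solve-∀

module _ where
  open import Data.Nat using (_<_; _+_; _*_; _^_)
  open import Data.Integer as ℤ using (+_; +<+)
  open import Data.Integer.Properties using (pos-*)
  open import Data.Rational.Properties using (toℚᵘ-cancel-<; toℚᵘ-fromℚᵘ)
  open import Data.Rational.Unnormalised using (mkℚᵘ; *<*)
  open import Data.Rational.Unnormalised.Properties using (≃-sym; <-respʳ-≃; <-respˡ-≃)
  open import Data.Nat.Tactic.RingSolver using (solve-∀)

  cross-multiply-< : ∀ p q d e .{{_ : NonZero d}} .{{_ : NonZero e}} →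
                   p * e < q * d → + p ℚ./ d ℚ.< + q ℚ./ e
  cross-multiply-< p q (suc d) (suc e) p*e<q*d =
    toℚᵘ-cancel-<
      (<-respʳ-≃ (≃-sym (toℚᵘ-fromℚᵘ (mkℚᵘ (+ q) e)))
        (<-respˡ-≃ (≃-sym (toℚᵘ-fromℚᵘ (mkℚᵘ (+ p) d)))
          (*<* (subst₂ ℤ._<_ (pos-* p (suc e)) (pos-* q (suc d)) (+<+ p*e<q*d)))))

  f-suc<f : ∀ m a r → (m C suc r) * a ^ suc r < a * binomSum m a r → f m a (suc r) ℚ.< f m a r
  f-suc<f m a r t<aS =
    cross-multiply-< (S + t) S ((1 + a) ^ suc r) Q {{ℕ.m^n≢0 (1 + a) (suc r)}} (begin-strict
      (S + t) * Q        ≡⟨ ℕ.*-distribʳ-+ Q S t ⟩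
      S * Q + t * Q      <⟨ ℕ.+-monoʳ-< (S * Q) (ℕ.*-monoˡ-< Q t<aS) ⟩
      S * Q + a * S * Q  ≡⟨ factor S a Q ⟩
      S * ((1 + a) * Q)  ∎)
    where
    open ℕ.≤-Reasoning
    S = binomSum m a r
    t = (m C suc r) * a ^ suc r
    Q = (1 + a) ^ r
    instance
      Q≢0 : NonZero Q
      Q≢0 = ℕ.m^n≢0 (1 + a) r
    factor : ∀ S a Q → S * Q + a * S * Q ≡ S * ((1 + a) * Q)
    factor = solve-∀

open import Data.Nat using (_≤_; _+_)
open import Data.Rational using (_>_)

proposition3p2 : (a m : ℕ) → 1 ≤ a → 2 ≤ m →
    f m a (rₐ m a) > f m a (rₐ m a + 1)
proposition3p2 a m 1≤a 2≤m =
  subst (λ s → f m a s ℚ.< f m a r) (ℕ.+-comm 1 r)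
    (f-suc<f m a r (term<a*partialSum m r 1≤a (rₐ-bound 1≤a 1≤m)))
  where
  r = rₐ m a
  1≤m : 1 ≤ m
  1≤m = ℕ.≤-trans (ℕ.n≤1+n 1) 2≤m
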